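{- Let $k\geq2$, $n\geq 1$, and let $\sigma=\sigma(1)\cdots\sigma((k-1)n)$ be the short $k$-Catalan--Spitzer permutation induced by a $k$-Catalan path $P$ of order $n$. If $\sigma(i)$ is the label of an up step of $P$ that is immediately followed by a down step, then the vertex $\sigma(i)$ has no right child in the Foata--Strehl tree $\mathcal{FS}(\sigma)$. If $\sigma(i)$ is the label of an up step of $P$ that is immediately followed by an up step, then $\sigma(i)$ has a right child $\sigma(j)$ in $\mathcal{FS}(\sigma)$, and the level of the up step labeled $\sigma(j)$ is one more than the level of the up step labeled $\sigma(i)$.
   Context: A $k$-Catalan path of order $n$ is a lattice path from $(0,0)$ to $(kn,0)$ consisting of $(k-1)n$ up steps $(1,1)$ and $n$ down steps $(1,1-k)$ never going below the $x$-axis; the level of an up step is the $y$-coordinate of its starting point. The short $k$-Catalan--Spitzer permutation induced by $P$ is obtained by labeling the up steps of $P$ bijectively with $1,\ldots,(k-1)n$ so that labels increase from right to left among up steps at the same level and every up step at a lower level gets a smaller label than every up step at a higher level, and recording the labels in the order the up steps occur along $P$. The Foata--Strehl tree $\mathcal{FS}(w_1\cdots w_m)$ of a word with distinct letters from an ordered alphabet is the rooted tree (each vertex having at most one left and at most one right child) defined recursively: its root is labeled $w_i=\min(w_1,\ldots,w_m)$, its left subtree is $\mathcal{FS}(w_1\cdots w_{i-1})$ (absent if $i=1$) and its right subtree is $\mathcal{FS}(w_{i+1}\cdots w_m)$ (absent if $i=m$); vertices are identified with their labels. -}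

module Defs where

open import Data.Nat using (ℕ; zero; suc; _+_; _*_; _∸_; _≤_; _<ᵇ_; _≡ᵇ_)
open import Data.Bool using (Bool; true; false; _∧_; _∨_; if_then_else_)
open import Data.List using (List; []; _∷_; length; take; upTo; map; filterᵇ)
open import Data.Maybe using (Maybe; just; nothing)
open import Data.Product using (_×_; ∃)
open import Relation.Binary.PropositionalEquality using (_≡_)

-- Steps of a k-Catalan path: U = (1,1), D = (1,1-k).
data Step : Set where
  U D : Step

_at_ : {A : Set} → List A → ℕ → Maybe A
[]       at _     = nothing
(x ∷ xs) at zero  = just x
(x ∷ xs) at suc i = xs at i

isU : Step → Bool
isU U = true
isU D = false

countU : List Step → ℕ
countU []       = 0
countU (U ∷ xs) = suc (countU xs)
countU (D ∷ xs) = countU xs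

countD : List Step → ℕ
countD []       = 0
countD (U ∷ xs) = countD xs
countD (D ∷ xs) = suc (countD xs)

record IsKCatalan (k n : ℕ) (P : List Step) : Set where
  field
    ups      : countU P ≡ (k ∸ 1) * n
    downs    : countD P ≡ n
    nonneg   : ∀ m → (k ∸ 1) * countD (take m P) ≤ countU (take m P)

-- Level of the step at (0-based) position p: y-coordinate of its starting point.
level : ℕ → List Step → ℕ → ℕ
level k P p = countU (take p P) ∸ (k ∸ 1) * countD (take p P)

isUpAt : List Step → ℕ → Bool
isUpAt P q with P at q
... | just U = true
... | _      = false

upPositions : List Step → List ℕ
upPositions P = filterᵇ (isUpAt P) (upTo (length P))

smallerLabel : ℕ → List Step → ℕ → ℕ → Bool
smallerLabel k P p q =
  (level k P q <ᵇ level k P p) ∨ ((level k P q ≡ᵇ level k P p) ∧ (p <ᵇ q))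

label : ℕ → List Step → ℕ → ℕ
label k P p = suc (length (filterᵇ (smallerLabel k P p) (upPositions P)))

spitzer : ℕ → List Step → List ℕ
spitzer k P = map (label k P) (upPositions P)

data Tree : Set where
  leaf : Tree
  node : Tree → ℕ → Tree → Tree

minimum : ℕ → List ℕ → ℕ
minimum m []       = m
minimum m (x ∷ xs) = if x <ᵇ m then minimum x xs else minimum m xs

splitAt : ℕ → List ℕ → List ℕ × List ℕ
splitAt m [] = [] Data.Product., []
splitAt m (x ∷ xs) with x ≡ᵇ m
... | true  = [] Data.Product., xs
... | false with splitAt m xs
...   | (l Data.Product., r) = (x ∷ l) Data.Product., r

-- FS tree, with fuel (fuel = length of the word suffices)
fsFuel : ℕ → List ℕ → Tree
fsFuel _       []       = leaf
fsFuel zero    (_ ∷ _)  = leaf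
fsFuel (suc f) (x ∷ xs) with minimum x xs
... | m with splitAt m (x ∷ xs)
...   | (l Data.Product., r) = node (fsFuel f l) m (fsFuel f r)

FS : List ℕ → Tree
FS w = fsFuel (length w) w

data RightChild : Tree → ℕ → ℕ → Set where
  here  : ∀ {l v l' c r'} → RightChild (node l v (node l' c r')) v c
  inL   : ∀ {l x r v c} → RightChild l v c → RightChild (node l x r) v c
  inR   : ∀ {l x r v c} → RightChild r v c → RightChild (node l x r) v c

-- If a vertex a of FS(w) has a right child, the letter following a in w is at least a;
-- conversely, if a is followed by a block of larger letters that ends with a smaller letter
-- or with w, the least letter of that block is the right child of a.
-- In σ the letter after the label of the up step at p is the label of the next up step.
-- If the step at p + 1 is a down step, the path stays at or below level(p) until that next
-- up step, which therefore gets a smaller label. If it is an up step, the larger letters that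
-- follow are the labels of the up steps above level(p) before the path first returns to it;
-- the least of them lies on the lowest of these levels, level(p) + 1, where step p + 1 starts.
module Submission where

open import Defs
open import Data.Bool using (T; true; false)
open import Data.Bool.Properties using (T-∨; T-∧)
open import Data.Empty using (⊥-elim)
open import Data.Nat
open import Data.Nat.Properties
open import Data.List using (List; []; _∷_; _++_; length; head; map; filter; applyUpTo; upTo; fromMaybe; take; takeWhile; dropWhile)
open import Data.List.Properties using (∷-injective; ++-assoc; ++-identityʳ; length-++-sucʳ; length-++-≤ˡ; length-++-≤ʳ; map-++; filter-++; filter-accept; filter-reject; filter-notAll; takeWhile++dropWhile)
open import Data.List.Membership.Propositional using (_∈_; _∉_; lose)
open import Data.List.Membership.Propositional.Properties using (∈-++⁺ˡ; ∈-++⁺ʳ; ∈-filter⁺; ∈-filter⁻; ∈-upTo⁺; ∈-map⁺; ∈-map⁻)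
open import Data.List.Relation.Unary.Any using (here; there)
open import Data.List.Relation.Unary.All using (All; []; _∷_)
import Data.List.Relation.Unary.All as All
open import Data.List.Relation.Unary.All.Properties using (++⁻ʳ; head⁺; map⁺; all-takeWhile; takeWhile⁺; dropWhile⁺; all-head-dropWhile)
open import Data.List.Extrema ≤-totalOrder using (argmin; argmin-all; f[argmin]≤f[⊤]; f[argmin]≤f[xs])
open import Data.Maybe using (just; nothing)
import Data.Maybe.Relation.Unary.All as Maybe
open import Data.Product using (∃; ∃₂; _×_; _,_; proj₁; proj₂)
import Data.Product as Product
open import Data.Sum using (_⊎_; inj₁; inj₂)
import Data.Sum as Sum
open import Function using (_∘_; id; Equivalence; _⇔_; mk⇔)
open import Level using (0ℓ)
open import Relation.Binary.Definitions using (tri<; tri≈; tri>)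
open import Relation.Binary.PropositionalEquality
open import Relation.Nullary using (¬_; yes; no; ofʸ; ofⁿ)
open import Relation.Nullary.Decidable using (T?)
open import Relation.Unary using (Pred; Decidable; _⊆_)

module _ {A : Set} where

  ++-∷-trichotomy : ∀ l (m : A) r xs a t → l ++ m ∷ r ≡ xs ++ a ∷ t →
    (l ≡ xs × m ≡ a × r ≡ t)
    ⊎ (∃ λ u → l ≡ xs ++ a ∷ u × t ≡ u ++ m ∷ r)
    ⊎ (∃ λ u → xs ≡ l ++ m ∷ u × r ≡ u ++ a ∷ t)
  ++-∷-trichotomy []      m r []       a t refl = inj₁ (refl , refl , refl)
  ++-∷-trichotomy []      m r (x ∷ xs) a t refl = inj₂ (inj₂ (xs , refl , refl))
  ++-∷-trichotomy (y ∷ l) m r []       a t refl = inj₂ (inj₁ (l , refl , refl))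
  ++-∷-trichotomy (y ∷ l) m r (x ∷ xs) a t e with refl , e′ ← ∷-injective e
    with ++-∷-trichotomy l m r xs a t e′
  ... | inj₁ (refl , m≡a , r≡t)        = inj₁ (refl , m≡a , r≡t)
  ... | inj₂ (inj₁ (u , refl , t≡))    = inj₂ (inj₁ (u , refl , t≡))
  ... | inj₂ (inj₂ (u , refl , r≡))    = inj₂ (inj₂ (u , refl , r≡))

  ∷-beyond-prefix : ∀ zs ys u (m : A) r → zs ++ ys ≡ u ++ m ∷ r → m ∉ zs →
                    ∃ λ v → u ≡ zs ++ v × ys ≡ v ++ m ∷ r
  ∷-beyond-prefix []       ys u       m r e _   = u , refl , e
  ∷-beyond-prefix (z ∷ zs) ys []      m r e m∉z∷zs = ⊥-elim (m∉z∷zs (here (sym (proj₁ (∷-injective e)))))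
  ∷-beyond-prefix (z ∷ zs) ys (x ∷ u) m r e m∉z∷zs with refl , e′ ← ∷-injective e
    with v , refl , ys≡ ← ∷-beyond-prefix zs ys u m r e′ (m∉z∷zs ∘ there) = v , refl , ys≡

  suffix-unique : ∀ {a : A} xs ys xs′ ys′ → xs ++ a ∷ ys ≡ xs′ ++ a ∷ ys′ →
                  a ∉ xs′ → a ∉ ys′ → ys ≡ ys′
  suffix-unique []       ys []        ys′ refl _     _     = refl
  suffix-unique []       ys (_ ∷ _)   ys′ refl a∉xs′ _     = ⊥-elim (a∉xs′ (here refl))
  suffix-unique (_ ∷ xs) ys []        ys′ refl _     a∉ys′ = ⊥-elim (a∉ys′ (∈-++⁺ʳ xs (here refl)))
  suffix-unique (_ ∷ xs) ys (_ ∷ xs′) ys′ e  a∉xs′ a∉ys′ =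
    suffix-unique xs ys xs′ ys′ (proj₂ (∷-injective e)) (a∉xs′ ∘ there) a∉ys′

  head-++⁻ : ∀ {P : A → Set} u v → Maybe.All P (head (u ++ v)) → Maybe.All P (head u)
  head-++⁻ []      v _  = Maybe.nothing
  head-++⁻ (_ ∷ _) v hd = hd

  filter-⊆-absorb : ∀ {P Q : Pred A 0ℓ} (P? : Decidable P) (Q? : Decidable Q) → P ⊆ Q →
                    ∀ xs → filter P? (filter Q? xs) ≡ filter P? xs
  filter-⊆-absorb P? Q? P⇒Q []       = refl
  filter-⊆-absorb P? Q? P⇒Q (x ∷ xs) with Q? x
  ... | yes _ with P? x
  ...   | yes _ = cong (x ∷_) (filter-⊆-absorb P? Q? P⇒Q xs)
  ...   | no  _ = filter-⊆-absorb P? Q? P⇒Q xs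
  filter-⊆-absorb P? Q? P⇒Q (x ∷ xs) | no ¬Qx =
    trans (filter-⊆-absorb P? Q? P⇒Q xs) (sym (filter-reject P? (¬Qx ∘ P⇒Q)))

  length-∷-split : ∀ l (m : A) r {f} → length (l ++ m ∷ r) ≤ suc f → length l ≤ f × length r ≤ f
  length-∷-split l m r {f} len = ≤-trans (length-++-≤ˡ l) len′ , ≤-trans (length-++-≤ʳ r {l}) len′
    where
      len′ : length (l ++ r) ≤ f
      len′ = s≤s⁻¹ (subst (_≤ suc f) (length-++-sucʳ l m r) len)

Adjacent : ℕ → ℕ → List ℕ → Set
Adjacent a b w = ∃₂ λ xs ys → w ≡ xs ++ a ∷ b ∷ ys

adjacent-++⁺ˡ : ∀ {a b l} r → Adjacent a b l → Adjacent a b (l ++ r)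
adjacent-++⁺ˡ r (xs , ys , refl) = xs , ys ++ r , ++-assoc xs (_ ∷ _ ∷ ys) r

adjacent-++⁺ʳ : ∀ {a b r} l → Adjacent a b r → Adjacent a b (l ++ r)
adjacent-++⁺ʳ l (xs , ys , refl) = l ++ xs , ys , sym (++-assoc l xs _)

adjacent-unique : ∀ {w pre suf a b} → w ≡ pre ++ a ∷ suf → a ∉ pre → a ∉ suf →
                  Adjacent a b w → head suf ≡ just b
adjacent-unique {pre = pre} {suf} {b = b} refl a∉pre a∉suf (xs , ys , e) =
  sym (cong head (suffix-unique xs (b ∷ ys) pre suf (sym e) a∉pre a∉suf))

range : ℕ → ℕ → List ℕ
range s zero    = []
range s (suc n) = s ∷ range (suc s) n

applyUpTo-range : ∀ {f : ℕ → ℕ} s n → (∀ i → f i ≡ s + i) → applyUpTo f n ≡ range s n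
applyUpTo-range s zero    _    = refl
applyUpTo-range s (suc n) f≗s+ =
  cong₂ _∷_ (trans (f≗s+ 0) (+-identityʳ s))
            (applyUpTo-range (suc s) n (λ i → trans (f≗s+ (suc i)) (+-suc s i)))

upTo-range : ∀ n → upTo n ≡ range 0 n
upTo-range n = applyUpTo-range 0 n (λ _ → refl)

range-++ : ∀ s a b → range s (a + b) ≡ range s a ++ range (s + a) b
range-++ s zero    b = cong (λ s′ → range s′ b) (sym (+-identityʳ s))
range-++ s (suc a) b = cong (s ∷_) (trans (range-++ (suc s) a b)
  (cong (λ s′ → range (suc s) a ++ range s′ b) (sym (+-suc s a))))

∈-range⁻ : ∀ s n {r} → r ∈ range s n → s ≤ r × r < s + n
∈-range⁻ s (suc n) (here refl) = ≤-refl , m<m+n s z<s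
∈-range⁻ s (suc n) {r} (there r∈) with s<r , r<s+n ← ∈-range⁻ (suc s) n r∈ =
  <⇒≤ s<r , subst (r <_) (sym (+-suc s n)) r<s+n

minimum-≤ : ∀ m xs → All (minimum m xs ≤_) (m ∷ xs)
minimum-≤ m []       = ≤-refl ∷ []
minimum-≤ m (x ∷ xs) with x <ᵇ m | <ᵇ-reflects-< x m
... | true  | ofʸ x<m with μ≤x ∷ μ≤xs ← minimum-≤ x xs = ≤-trans μ≤x (<⇒≤ x<m) ∷ μ≤x ∷ μ≤xs
... | false | ofⁿ x≮m with μ≤m ∷ μ≤xs ← minimum-≤ m xs = μ≤m ∷ ≤-trans μ≤m (≮⇒≥ x≮m) ∷ μ≤xs

minimum-∈ : ∀ m xs → minimum m xs ∈ m ∷ xs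
minimum-∈ m []       = here refl
minimum-∈ m (x ∷ xs) with x <ᵇ m
... | true  = there (minimum-∈ x xs)
... | false with minimum-∈ m xs
...   | here μ≡m  = here μ≡m
...   | there μ∈xs = there (there μ∈xs)

minimum-≡ : ∀ {c} m xs → c ∈ m ∷ xs → All (c ≤_) (m ∷ xs) → minimum m xs ≡ c
minimum-≡ m xs c∈ c≤ = ≤-antisym (All.lookup (minimum-≤ m xs) c∈) (All.lookup c≤ (minimum-∈ m xs))

splitAt-++ : ∀ {m} w → m ∈ w → proj₁ (splitAt m w) ++ m ∷ proj₂ (splitAt m w) ≡ w
splitAt-++ {m} (x ∷ xs) m∈ with x ≡ᵇ m | ≡ᵇ⇒≡ x m | ≡⇒≡ᵇ x m
... | true  | x≡m | _ = cong (_∷ xs) (sym (x≡m _))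
... | false | _ | x≢m with m∈
...   | here m≡x    = ⊥-elim (x≢m (sym m≡x))
...   | there m∈xs  = cong (x ∷_) (splitAt-++ xs m∈xs)

root-split : ∀ x xs → let m = minimum x xs in
             proj₁ (splitAt m (x ∷ xs)) ++ m ∷ proj₂ (splitAt m (x ∷ xs)) ≡ x ∷ xs
root-split x xs = splitAt-++ (x ∷ xs) (minimum-∈ x xs)

rightChild-node⁻ : ∀ {tl m tr a c} → RightChild (node tl m tr) a c →
  (a ≡ m × ∃₂ λ t t′ → tr ≡ node t c t′) ⊎ RightChild tl a c ⊎ RightChild tr a c
rightChild-node⁻ here      = inj₁ (refl , _ , _ , refl)
rightChild-node⁻ (inL rc)  = inj₂ (inj₁ rc)
rightChild-node⁻ (inR rc)  = inj₂ (inj₂ rc)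

fsFuel-node⁻ : ∀ f w {t c t′} → fsFuel f w ≡ node t c t′ → ∃₂ λ b ys → w ≡ b ∷ ys
fsFuel-node⁻ f       []      ()
fsFuel-node⁻ zero    (_ ∷ _) ()
fsFuel-node⁻ (suc f) (b ∷ ys) _ = b , ys , refl

mutual
  rightChild⇒ascent : ∀ f w {a c} → RightChild (fsFuel f w) a c → ∃ λ b → Adjacent a b w × a ≤ b
  rightChild⇒ascent f       []       ()
  rightChild⇒ascent zero    (_ ∷ _)  ()
  rightChild⇒ascent (suc f) (x ∷ xs) rc =
    node⇒ascent f (root-split x xs) (minimum-≤ x xs) rc

  node⇒ascent : ∀ f {l m r w a c} → l ++ m ∷ r ≡ w → All (m ≤_) w →
                RightChild (node (fsFuel f l) m (fsFuel f r)) a c → ∃ λ b → Adjacent a b w × a ≤ b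
  node⇒ascent f {l} {r = r} refl m≤w rc with rightChild-node⁻ rc
  ... | inj₁ (refl , _ , _ , r≡node) with b , ys , refl ← fsFuel-node⁻ f r r≡node
    with _ ∷ m≤b ∷ _ ← ++⁻ʳ l m≤w = b , (l , ys , refl) , m≤b
  ... | inj₂ (inj₁ rcl) with b , adj , a≤b ← rightChild⇒ascent f l rcl = b , adjacent-++⁺ˡ _ adj , a≤b
  ... | inj₂ (inj₂ rcr) with b , adj , a≤b ← rightChild⇒ascent f r rcr =
    b , adjacent-++⁺ʳ l (adjacent-++⁺ʳ (_ ∷ []) adj) , a≤b

record BlockAbove (a c : ℕ) (zs : List ℕ) : Set where
  field
    above : All (a <_) zs
    least : c ∈ zs
    least≤ : All (c ≤_) zs

open BlockAbove

least⇒rightChild : ∀ f zs {t a c} → length zs ≤ f → c ∈ zs → All (c ≤_) zs →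
                   RightChild (node t a (fsFuel f zs)) a c
least⇒rightChild (suc f) (z ∷ zs) _ c∈ c≤ = subst (RightChild _ _) (minimum-≡ z zs c∈ c≤) here

mutual
  block⇒rightChild : ∀ f w {xs a zs ys c} → length w ≤ f → w ≡ xs ++ a ∷ zs ++ ys →
                     BlockAbove a c zs → Maybe.All (_< a) (head ys) → RightChild (fsFuel f w) a c
  block⇒rightChild f       [] {[]}    _  ()
  block⇒rightChild f       [] {_ ∷ _} _  ()
  block⇒rightChild zero    (_ ∷ _)    () _
  block⇒rightChild (suc f) (x ∷ xs)   len =
    node-block⇒rightChild f (root-split x xs) (minimum-≤ x xs) len

  node-block⇒rightChild : ∀ f {l m r w xs a zs ys c} → l ++ m ∷ r ≡ w → All (m ≤_) w →
    length w ≤ suc f → w ≡ xs ++ a ∷ zs ++ ys → BlockAbove a c zs → Maybe.All (_< a) (head ys) →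
    RightChild (node (fsFuel f l) m (fsFuel f r)) a c
  node-block⇒rightChild f {l} {m} {r} {xs = xs} {a} {zs} {ys} refl m≤w len e block hd
    with len-l , len-r ← length-∷-split l m r len
    with ++-∷-trichotomy l m r xs a (zs ++ ys) e
  ... | inj₁ (refl , refl , refl) with ys | hd
  ...   | _ ∷ _ | Maybe.just y<a =
          ⊥-elim (<⇒≱ y<a (All.lookup m≤w (∈-++⁺ʳ xs (there (∈-++⁺ʳ zs (here refl))))))
  ...   | [] | Maybe.nothing rewrite ++-identityʳ zs =
          least⇒rightChild f zs len-r (least block) (least≤ block)
  node-block⇒rightChild f {l} {m} {r} {xs = xs} {a} {zs} {ys} refl m≤w len e block hd
    | inj₂ (inj₁ (u , refl , zs++ys≡))
    -- the root m ≤ a lies to the right of a but cannot lie in the block, so it lies in ys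
    with v , refl , refl ← ∷-beyond-prefix zs ys u m r zs++ys≡
           (λ m∈zs → <⇒≱ (All.lookup (above block) m∈zs) (All.lookup m≤w (∈-++⁺ˡ (∈-++⁺ʳ xs (here refl)))))
    = inL (block⇒rightChild f _ len-l refl block (head-++⁻ v _ hd))
  node-block⇒rightChild f refl _ _ _ block hd
    | inj₂ (inj₂ (u , refl , refl)) = inR (block⇒rightChild f _ len-r refl block hd)

at⇒< : ∀ (P : List Step) q {x} → P at q ≡ just x → q < length P
at⇒< (_ ∷ P) zero    _ = z<s
at⇒< (_ ∷ P) (suc q) e = s<s (at⇒< P q e)

take-suc : ∀ (P : List Step) s → take (suc s) P ≡ take s P ++ fromMaybe (P at s)
take-suc []      zero    = refl
take-suc []      (suc s) = refl
take-suc (_ ∷ P) zero    = refl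
take-suc (x ∷ P) (suc s) = cong (x ∷_) (take-suc P s)

countU-++ : ∀ xs ys → countU (xs ++ ys) ≡ countU xs + countU ys
countU-++ []       ys = refl
countU-++ (U ∷ xs) ys = cong suc (countU-++ xs ys)
countU-++ (D ∷ xs) ys = countU-++ xs ys

countD-++ : ∀ xs ys → countD (xs ++ ys) ≡ countD xs + countD ys
countD-++ []       ys = refl
countD-++ (U ∷ xs) ys = countD-++ xs ys
countD-++ (D ∷ xs) ys = cong suc (countD-++ xs ys)

module Labelling (k : ℕ) (P : List Step) where

  lv : ℕ → ℕ
  lv = level k P

  lab : ℕ → ℕ
  lab = label k P

  Up : ℕ → Set
  Up q = T (isUpAt P q)

  up? : Decidable Up
  up? = T? ∘ isUpAt P

  ups : List ℕ → List ℕ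
  ups = filter up?

  Nonnegative : Set
  Nonnegative = ∀ m → (k ∸ 1) * countD (take m P) ≤ countU (take m P)

  _≺_ : ℕ → ℕ → Set
  q ≺ p = lv q < lv p ⊎ (lv q ≡ lv p × p < q)

  ≺-trans : ∀ {q r p} → q ≺ r → r ≺ p → q ≺ p
  ≺-trans (inj₁ q<r)         (inj₁ r<p)         = inj₁ (<-trans q<r r<p)
  ≺-trans (inj₁ q<r)         (inj₂ (r≡p , _))   = inj₁ (<-≤-trans q<r (≤-reflexive r≡p))
  ≺-trans (inj₂ (q≡r , _))   (inj₁ r<p)         = inj₁ (≤-<-trans (≤-reflexive q≡r) r<p)
  ≺-trans (inj₂ (q≡r , r<q)) (inj₂ (r≡p , p<r)) = inj₂ (trans q≡r r≡p , <-trans p<r r<q)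

  ≺-irrefl : ∀ {q} → ¬ q ≺ q
  ≺-irrefl (inj₁ q<q)       = <-irrefl refl q<q
  ≺-irrefl (inj₂ (_ , q<q)) = <-irrefl refl q<q

  ≺-connex : ∀ {q p} → q ≢ p → q ≺ p ⊎ p ≺ q
  ≺-connex {q} {p} q≢p with <-cmp (lv q) (lv p) | <-cmp q p
  ... | tri< lq<lp _ _ | _               = inj₁ (inj₁ lq<lp)
  ... | tri> _ _ lp<lq | _               = inj₂ (inj₁ lp<lq)
  ... | tri≈ _ lq≡lp _ | tri< q<p _ _    = inj₂ (inj₂ (sym lq≡lp , q<p))
  ... | tri≈ _ _ _     | tri≈ _ q≡p _    = ⊥-elim (q≢p q≡p)
  ... | tri≈ _ lq≡lp _ | tri> _ _ p<q    = inj₁ (inj₂ (lq≡lp , p<q))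

  smallerLabel⇔≺ : ∀ p q → T (smallerLabel k P p q) ⇔ q ≺ p
  smallerLabel⇔≺ p q = mk⇔
    (Sum.map (<ᵇ⇒< _ _) (Product.map (≡ᵇ⇒≡ _ _) (<ᵇ⇒< _ _) ∘ Equivalence.to T-∧) ∘ Equivalence.to T-∨)
    (Equivalence.from T-∨ ∘ Sum.map <⇒<ᵇ (Equivalence.from T-∧ ∘ Product.map (≡⇒≡ᵇ _ _) <⇒<ᵇ))

  Up⇒U : ∀ q → Up q → P at q ≡ just U
  Up⇒U q up with P at q
  ... | just U = refl

  U⇒Up : ∀ q → P at q ≡ just U → Up q
  U⇒Up q e with P at q
  ... | just U = _

  D⇒¬Up : ∀ q → P at q ≡ just D → ¬ Up q
  D⇒¬Up q e with P at q
  D⇒¬Up q refl | just D = λ ()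

  ∈-upPositions : ∀ {q} → Up q → q ∈ upPositions P
  ∈-upPositions {q} up = ∈-filter⁺ up? (∈-upTo⁺ (at⇒< P q (Up⇒U q up))) up

  label-mono : ∀ {q p} → Up q → q ≺ p → lab q < lab p
  label-mono {q} {p} up q≺p = s≤s (begin-strict
    length (filter (sl q) (upPositions P))
      ≡⟨ cong length (sym (filter-⊆-absorb (sl q) (sl p) (λ {r} → r≺q⇒r≺p {r}) (upPositions P))) ⟩
    length (filter (sl q) (smaller p))
      <⟨ filter-notAll (sl q) (smaller p) (lose q∈smaller-p ¬q≺q) ⟩
    length (smaller p)
      ∎)
    where
      open ≤-Reasoning
      sl : ∀ x → Decidable (T ∘ smallerLabel k P x)
      sl x = T? ∘ smallerLabel k P x
      smaller : ℕ → List ℕ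
      smaller x = filter (sl x) (upPositions P)
      r≺q⇒r≺p : ∀ {r} → T (smallerLabel k P q r) → T (smallerLabel k P p r)
      r≺q⇒r≺p {r} r≺q =
        Equivalence.from (smallerLabel⇔≺ p r) (≺-trans (Equivalence.to (smallerLabel⇔≺ q r) r≺q) q≺p)
      q∈smaller-p : q ∈ smaller p
      q∈smaller-p = ∈-filter⁺ (sl p) (∈-upPositions up) (Equivalence.from (smallerLabel⇔≺ p q) q≺p)
      ¬q≺q : ¬ T (smallerLabel k P q q)
      ¬q≺q = ≺-irrefl {q} ∘ Equivalence.to (smallerLabel⇔≺ q q)

  label-injective : ∀ {q p} → Up q → Up p → lab q ≡ lab p → q ≡ p
  label-injective {q} {p} up-q up-p eq with q ≟ p
  ... | yes q≡p = q≡p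
  ... | no  q≢p with ≺-connex q≢p
  ...   | inj₁ q≺p = ⊥-elim (<⇒≢ (label-mono up-q q≺p) eq)
  ...   | inj₂ p≺q = ⊥-elim (<⇒≢ (label-mono up-p p≺q) (sym eq))

  level-step : ∀ s {x} → P at s ≡ just x →
    lv (suc s) ≡ (countU (take s P) + countU (x ∷ [])) ∸ (k ∸ 1) * (countD (take s P) + countD (x ∷ []))
  level-step s e rewrite take-suc P s | e =
    cong₂ (λ u d → u ∸ (k ∸ 1) * d) (countU-++ (take s P) _) (countD-++ (take s P) _)

  level-U : Nonnegative → ∀ s → P at s ≡ just U → lv (suc s) ≡ suc (lv s)
  level-U nonneg s e = begin
    lv (suc s)                                ≡⟨ level-step s e ⟩
    (#U + 1) ∸ (k ∸ 1) * (#D + 0)             ≡⟨ cong (λ d → (#U + 1) ∸ (k ∸ 1) * d) (+-identityʳ #D) ⟩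
    (#U + 1) ∸ (k ∸ 1) * #D                   ≡⟨ +-∸-comm 1 (nonneg s) ⟩
    lv s + 1                                  ≡⟨ +-comm (lv s) 1 ⟩
    suc (lv s)                                ∎
    where
      open ≡-Reasoning
      #U = countU (take s P)
      #D = countD (take s P)

  level-D : ∀ s → P at s ≡ just D → lv (suc s) ≡ lv s ∸ (k ∸ 1)
  level-D s e = begin
    lv (suc s)                                ≡⟨ level-step s e ⟩
    (#U + 0) ∸ (k ∸ 1) * (#D + 1)             ≡⟨ cong₂ _∸_ (+-identityʳ #U) (*-distribˡ-+ (k ∸ 1) #D 1) ⟩
    #U ∸ ((k ∸ 1) * #D + (k ∸ 1) * 1)         ≡⟨ cong (λ d → #U ∸ ((k ∸ 1) * #D + d)) (*-identityʳ (k ∸ 1)) ⟩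
    #U ∸ ((k ∸ 1) * #D + (k ∸ 1))             ≡⟨ ∸-+-assoc #U ((k ∸ 1) * #D) (k ∸ 1) ⟨
    lv s ∸ (k ∸ 1)                            ∎
    where
      open ≡-Reasoning
      #U = countU (take s P)
      #D = countD (take s P)

  level-end : ∀ s → P at s ≡ nothing → lv (suc s) ≡ lv s
  level-end s e rewrite take-suc P s | e | ++-identityʳ (take s P) = refl

  level-¬Up : ∀ s → ¬ Up s → lv (suc s) ≤ lv s
  level-¬Up s ¬up with P at s in e
  ... | just U  = ⊥-elim (¬up _)
  ... | just D  = ≤-trans (≤-reflexive (level-D s e)) (m∸n≤m (lv s) (k ∸ 1))
  ... | nothing = ≤-reflexive (level-end s e)

  ups-range : ∀ s N → All (λ r → Up r × s ≤ r × r < s + N) (ups (range s N))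
  ups-range s N = All.tabulate λ r∈ → let r∈range , up = ∈-filter⁻ up? r∈ in up , ∈-range⁻ s N r∈range

  first-up-level : ∀ s N → Maybe.All (λ r → lv r ≤ lv s) (head (ups (range s N)))
  first-up-level s zero    = Maybe.nothing
  first-up-level s (suc N) with T? (isUpAt P s)
  ... | yes up rewrite filter-accept up? {xs = range (suc s) N} up = Maybe.just ≤-refl
  ... | no ¬up rewrite filter-reject up? {xs = range (suc s) N} ¬up =
    Maybe.map (λ r≤ → ≤-trans r≤ (level-¬Up s ¬up)) (first-up-level (suc s) N)

  rest : ℕ → ℕ
  rest p = length P ∸ suc (suc p)

  spitzer-split : ∀ p → Up p → suc p < length P →
    spitzer k P ≡ map lab (ups (range 0 p)) ++ lab p ∷ map lab (ups (range (suc p) (suc (rest p))))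
  spitzer-split p up p+1<len = begin
    map lab (ups (upTo (length P)))                   ≡⟨ cong (map lab ∘ ups) (trans (cong upTo len≡) (upTo-range _)) ⟩
    map lab (ups (range 0 (p + suc n)))               ≡⟨ cong (map lab ∘ ups) (range-++ 0 p (suc n)) ⟩
    map lab (ups (range 0 p ++ p ∷ later))            ≡⟨ cong (map lab) (filter-++ up? (range 0 p) _) ⟩
    map lab (ups (range 0 p) ++ ups (p ∷ later))      ≡⟨ cong (λ S → map lab (ups (range 0 p) ++ S)) (filter-accept up? up) ⟩
    map lab (ups (range 0 p) ++ p ∷ ups later)        ≡⟨ map-++ lab (ups (range 0 p)) _ ⟩
    map lab (ups (range 0 p)) ++ lab p ∷ map lab (ups later) ∎
    where
      open ≡-Reasoning
      n : ℕ
      n = suc (rest p)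
      later : List ℕ
      later = range (suc p) n
      len≡ : length P ≡ p + suc n
      len≡ = begin
        length P                ≡⟨ m+[n∸m]≡n p+1<len ⟨
        suc (suc p) + rest p    ≡⟨ cong suc (+-suc p (rest p)) ⟨
        suc (p + n)             ≡⟨ +-suc p n ⟨
        p + suc n               ∎

  label-∉ : ∀ {p S} → Up p → All (λ r → Up r × r ≢ p) S → lab p ∉ map lab S
  label-∉ up-p rs p∈ with r , r∈ , lp≡lr ← ∈-map⁻ lab p∈ with up-r , r≢p ← All.lookup rs r∈ =
    r≢p (label-injective up-r up-p (sym lp≡lr))

  head-labels-below : ∀ {p} S → Maybe.All (λ r → Up r × r ≺ p) (head S) →
                      Maybe.All (_< lab p) (head (map lab S))
  head-labels-below []      _                          = Maybe.nothing
  head-labels-below (_ ∷ _) (Maybe.just (up , r≺p)) = Maybe.just (label-mono up r≺p)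

  not-above⇒≺ : ∀ {p r} → p < r → lv r ≤ lv p → r ≺ p
  not-above⇒≺ p<r r≤p = Sum.map id (_, p<r) (m≤n⇒m<n∨m≡n r≤p)

  up-down-level : 2 ≤ k → Nonnegative → ∀ p → P at p ≡ just U → P at suc p ≡ just D →
                  lv (suc (suc p)) ≤ lv p
  up-down-level k≥2 nonneg p Uₚ Dₚ₊₁ = begin
    lv (suc (suc p))       ≡⟨ level-D (suc p) Dₚ₊₁ ⟩
    lv (suc p) ∸ (k ∸ 1)   ≡⟨ cong (_∸ (k ∸ 1)) (level-U nonneg p Uₚ) ⟩
    suc (lv p) ∸ (k ∸ 1)   ≤⟨ ∸-monoʳ-≤ (suc (lv p)) (∸-monoˡ-≤ 1 k≥2) ⟩
    lv p                   ∎
    where open ≤-Reasoning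

  least-label-level : ∀ {L t} zs → All (λ r → Up r × L < lv r) (t ∷ zs) → lv t ≡ suc L →
                      lv (argmin lab t zs) ≡ suc L
  least-label-level {L} {t} zs rs lv-t≡ =
    ≤-antisym (≮⇒≥ not-higher) (proj₂ (argmin-all lab (All.head rs) (All.tail rs)))
    where
      q : ℕ
      q = argmin lab t zs
      not-higher : ¬ suc L < lv q
      not-higher L<q = <⇒≱ (label-mono (proj₁ (All.head rs)) (inj₁ (subst (_< lv q) (sym lv-t≡) L<q)))
                           (f[argmin]≤f[⊤] {f = lab} t zs)

  up-down⇒no-rightChild : 2 ≤ k → Nonnegative → ∀ p → P at p ≡ just U → P at suc p ≡ just D →
                          ¬ ∃ λ c → RightChild (FS (spitzer k P)) (lab p) c
  up-down⇒no-rightChild k≥2 nonneg p Uₚ Dₚ₊₁ (_ , rc) = no-ascent (rightChild⇒ascent _ _ rc)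
    where
      up-p : Up p
      up-p = U⇒Up p Uₚ
      S : List ℕ
      S = ups (range (suc p) (suc (rest p)))
      spitzer≡ : spitzer k P ≡ map lab (ups (range 0 p)) ++ lab p ∷ map lab S
      spitzer≡ = spitzer-split p up-p (at⇒< P (suc p) Dₚ₊₁)
      lp∉before : lab p ∉ map lab (ups (range 0 p))
      lp∉before = label-∉ up-p (All.map (λ (up , _ , r<p) → up , <⇒≢ r<p) (ups-range 0 p))
      lp∉after : lab p ∉ map lab S
      lp∉after = label-∉ up-p (All.map (λ (up , p<r , _) → up , >⇒≢ p<r) (ups-range (suc p) (suc (rest p))))
      successor-below : Maybe.All (_< lab p) (head (map lab S))
      successor-below rewrite filter-reject up? {xs = range (suc (suc p)) (rest p)} (D⇒¬Up (suc p) Dₚ₊₁) =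
        head-labels-below _ (Maybe.zipWith below-p
          (head⁺ (ups-range (suc (suc p)) (rest p)) , first-up-level (suc (suc p)) (rest p)))
        where
          below-p : ∀ {r} → (Up r × suc (suc p) ≤ r × _) × lv r ≤ lv (suc (suc p)) → Up r × r ≺ p
          below-p ((up , p+2≤r , _) , r≤p+2) =
            up , not-above⇒≺ (<-trans (n<1+n p) p+2≤r) (≤-trans r≤p+2 (up-down-level k≥2 nonneg p Uₚ Dₚ₊₁))
      no-ascent : ¬ ∃ λ b → Adjacent (lab p) b (spitzer k P) × lab p ≤ b
      no-ascent (b , adj , lp≤b)
        with Maybe.just b<lp ←
          subst (Maybe.All (_< lab p)) (adjacent-unique spitzer≡ lp∉before lp∉after adj) successor-below
        = <⇒≱ b<lp lp≤b

  up-up⇒rightChild : Nonnegative → ∀ p → P at p ≡ just U → P at suc p ≡ just U →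
    ∃ λ q → P at q ≡ just U × RightChild (FS (spitzer k P)) (lab p) (lab q) × lv q ≡ suc (lv p)
  up-up⇒rightChild nonneg p Uₚ Uₚ₊₁ =
    q , Up⇒U q (proj₁ (argmin-all lab (All.head Z-facts) (All.tail Z-facts))) ,
    block⇒rightChild _ _ ≤-refl spitzer≡ block (head-labels-below Y Y-head) ,
    least-label-level Z′ Z-facts lv-p+1
    where
      up-p : Up p
      up-p = U⇒Up p Uₚ
      lv-p+1 : lv (suc p) ≡ suc (lv p)
      lv-p+1 = level-U nonneg p Uₚ
      above? : Decidable (λ r → lv p < lv r)
      above? r = lv p <? lv r
      later S′ : List ℕ
      later = range (suc (suc p)) (rest p)
      S′ = ups later
      Z′ Y : List ℕ
      Z′ = takeWhile above? S′
      Y = dropWhile above? S′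
      q : ℕ
      q = argmin lab (suc p) Z′
      S′-facts : All (λ r → Up r × suc (suc p) ≤ r × r < suc (suc p) + rest p) S′
      S′-facts = ups-range (suc (suc p)) (rest p)
      Z-facts : All (λ r → Up r × lv p < lv r) (suc p ∷ Z′)
      Z-facts = (U⇒Up (suc p) Uₚ₊₁ , subst (lv p <_) (sym lv-p+1) ≤-refl)
              ∷ All.zip (takeWhile⁺ above? (All.map proj₁ S′-facts) , all-takeWhile above? S′)
      spitzer≡ : spitzer k P ≡ map lab (ups (range 0 p)) ++ lab p ∷ map lab (suc p ∷ Z′) ++ map lab Y
      spitzer≡ = trans (spitzer-split p up-p (at⇒< P (suc p) Uₚ₊₁))
                       (cong (λ S → map lab (ups (range 0 p)) ++ lab p ∷ S) suffix≡)
        where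
          open ≡-Reasoning
          suffix≡ : map lab (ups (range (suc p) (suc (rest p)))) ≡ map lab (suc p ∷ Z′) ++ map lab Y
          suffix≡ = begin
            map lab (ups (suc p ∷ later))      ≡⟨ cong (map lab) (filter-accept up? (U⇒Up (suc p) Uₚ₊₁)) ⟩
            map lab (suc p ∷ S′)               ≡⟨ cong (map lab ∘ (suc p ∷_)) (takeWhile++dropWhile above? S′) ⟨
            map lab (suc p ∷ Z′ ++ Y)          ≡⟨ map-++ lab (suc p ∷ Z′) Y ⟩
            map lab (suc p ∷ Z′) ++ map lab Y  ∎
      block : BlockAbove (lab p) (lab q) (map lab (suc p ∷ Z′))
      block = record
        { above  = map⁺ (All.map (label-mono up-p ∘ inj₁ ∘ proj₂) Z-facts)
        ; least  = ∈-map⁺ lab (argmin-all lab {P = _∈ suc p ∷ Z′} (here refl) (All.tabulate there))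
        ; least≤ = map⁺ (f[argmin]≤f[⊤] {f = lab} (suc p) Z′ ∷ f[argmin]≤f[xs] {f = lab} (suc p) Z′)
        }
      Y-head : Maybe.All (λ r → Up r × r ≺ p) (head Y)
      Y-head = Maybe.zipWith
        (λ ((up , p+2≤r , _) , ¬above) → up , not-above⇒≺ (<-trans (n<1+n p) p+2≤r) (≮⇒≥ ¬above))
        (head⁺ (dropWhile⁺ above? S′-facts) , all-head-dropWhile above? S′)

lemma4p6 : (k n : ℕ) → 2 ≤ k → 1 ≤ n → (P : List Step) → IsKCatalan k n P →
           (∀ p → P at p ≡ just U → P at suc p ≡ just D →
              ¬ ∃ λ c → RightChild (FS (spitzer k P)) (label k P p) c)
         × (∀ p → P at p ≡ just U → P at suc p ≡ just U →
              ∃ λ q → (P at q ≡ just U)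
                    × RightChild (FS (spitzer k P)) (label k P p) (label k P q)
                    × level k P q ≡ suc (level k P p))
lemma4p6 k _ k≥2 _ P catalan = up-down⇒no-rightChild k≥2 nonneg , up-up⇒rightChild nonneg
  where
    open Labelling k P
    nonneg : Nonnegative
    nonneg = IsKCatalan.nonneg catalan
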